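{- Let $T$ be an Erdős–Szekeres tableau and let $t_r=(x_r,y_r)$ and $t_s=(x_s,y_s)$ be consecutive corner points of $T$, with $x_r<x_s$ (so $y_r>y_s$). Then there is a chain $r<_P c_1<_P\cdots<_P c_k<_P s$ in $P=P(T)$ with $k\ge (y_r-y_s)+(x_s-x_r)-1$ intermediate elements.
   Context: For a sequence $A=(a_1,\dots,a_n)$ of distinct reals, $a_i^+$ (resp. $a_i^-$) is the length of the longest increasing (resp. decreasing) subsequence ending at $a_i$; the EST is $T(A)=(t_i)_{i\le n}$ with $t_i=(a_i^+,a_i^-)$. $\mathrm{Col}(x,y)=\{(x,y'): y'>y\}$, $\mathrm{Row}(x,y)=\{(x',y): x'>x\}$. The shadow is $S(T)=\bigcup_i\big(\{(x,y_i):1\le x\le x_i\}\cup\{(x_i,y):1\le y\le y_i\}\big)$ where $t_i=(x_i,y_i)$. Edge points: $E(T)=\{t\in T:\mathrm{Col}(t)\cap T=\emptyset\text{ or }\mathrm{Row}(t)\cap T=\emptyset\}$. Corner points: $C(T)=\{(x,y)\in E(T): (x+1,y)\notin S(T)\text{ and }(x,y+1)\notin S(T)\}$. Listing the corner points in order of increasing $x$-coordinate (equivalently, decreasing $y$-coordinate), two corner points adjacent in this list are called consecutive. A sequence $A$ is identified with the linear order $i<_A j$ iff $a_i<a_j$ on $[n]$; $[T]$ is the set of such orders with $T(A)=T$; the order poset $P(T)$ on $[n]$ has $i<_{P(T)}j$ iff $i<_A j$ for all $A\in[T]$. -}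

module Defs where

open import Data.Nat using (ℕ; zero; suc; _+_; _∸_; _≤_; _<_; _>_)
open import Data.Fin using (Fin; zero; suc; inject₁; fromℕ) renaming (_<_ to _<ᶠ_)
open import Data.Product using (Σ; ∃; _×_; _,_; proj₁; proj₂)
open import Data.Sum using (_⊎_)
open import Data.Empty using (⊥)
open import Relation.Nullary using (¬_)
open import Relation.Binary.PropositionalEquality using (_≡_)
open import Function.Definitions using (Injective)

-- A sequence of n distinct numbers (only the relative order matters, so
-- distinct naturals stand in for distinct reals).
Seq : ℕ → Set
Seq n = Fin n → ℕ

Distinct : ∀ {n} → Seq n → Set
Distinct A = Injective _≡_ _≡_ A

Point : Set
Point = ℕ × ℕ

IncSubseqEndingAt : ∀ {n} → Seq n → Fin n → ℕ → Set
IncSubseqEndingAt {n} A i zero = ⊥  -- a subsequence ending at i has length ≥ 1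
IncSubseqEndingAt {n} A i (suc L) =
  Σ (Fin (suc L) → Fin n) λ p →
    (∀ (j : Fin L) → p (inject₁ j) <ᶠ p (suc j)) ×
    (∀ (j : Fin L) → A (p (inject₁ j)) < A (p (suc j))) ×
    (p (fromℕ L) ≡ i)

DecSubseqEndingAt : ∀ {n} → Seq n → Fin n → ℕ → Set
DecSubseqEndingAt {n} A i zero = ⊥
DecSubseqEndingAt {n} A i (suc L) =
  Σ (Fin (suc L) → Fin n) λ p →
    (∀ (j : Fin L) → p (inject₁ j) <ᶠ p (suc j)) ×
    (∀ (j : Fin L) → A (p (inject₁ j)) > A (p (suc j))) ×
    (p (fromℕ L) ≡ i)

IsLongestInc : ∀ {n} → Seq n → Fin n → ℕ → Set
IsLongestInc A i L = IncSubseqEndingAt A i L × (∀ L' → IncSubseqEndingAt A i L' → L' ≤ L)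

IsLongestDec : ∀ {n} → Seq n → Fin n → ℕ → Set
IsLongestDec A i L = DecSubseqEndingAt A i L × (∀ L' → DecSubseqEndingAt A i L' → L' ≤ L)

IsEST : ∀ {n} → Seq n → (Fin n → Point) → Set
IsEST A t = ∀ i → IsLongestInc A i (proj₁ (t i)) × IsLongestDec A i (proj₂ (t i))

_∈T_ : ∀ {n} → Point → (Fin n → Point) → Set
p ∈T t = ∃ λ i → t i ≡ p

InCol : Point → Point → Set
InCol (x , y) (x' , y') = x' ≡ x × y' > y

InRow : Point → Point → Set
InRow (x , y) (x' , y') = y' ≡ y × x' > x

InShadow : ∀ {n} → (Fin n → Point) → Point → Set
InShadow t (x , y) = ∃ λ i →
  (y ≡ proj₂ (t i) × 1 ≤ x × x ≤ proj₁ (t i)) ⊎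
  (x ≡ proj₁ (t i) × 1 ≤ y × y ≤ proj₂ (t i))

IsEdge : ∀ {n} → (Fin n → Point) → Point → Set
IsEdge t p = p ∈T t × ((¬ ∃ λ q → q ∈T t × InCol p q) ⊎ (¬ ∃ λ q → q ∈T t × InRow p q))

IsCorner : ∀ {n} → (Fin n → Point) → Point → Set
IsCorner t (x , y) = IsEdge t (x , y) × ¬ InShadow t (suc x , y) × ¬ InShadow t (x , suc y)

ConsecutiveCorners : ∀ {n} → (Fin n → Point) → Point → Point → Set
ConsecutiveCorners t p q =
  IsCorner t p × IsCorner t q × proj₁ p < proj₁ q ×
  (∀ c → IsCorner t c → ¬ (proj₁ p < proj₁ c × proj₁ c < proj₁ q))

_<[_]_ : ∀ {n} → Fin n → (Fin n → Point) → Fin n → Set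
_<[_]_ {n} i t j = ∀ (B : Seq n) → Distinct B → IsEST B t → B i < B j

ChainWith : ∀ {n} → (Fin n → Point) → Fin n → Fin n → ℕ → Set
ChainWith {n} t r s k =
  Σ (Fin (suc (suc k)) → Fin n) λ c →
    (c zero ≡ r) × (c (fromℕ (suc k)) ≡ s) ×
    (∀ (j : Fin (suc k)) → c (inject₁ j) <[ t ] c (suc j))

module Submission where

-- Write x i, y i for the coordinates of t i.  For every sequence B with EST t, x ranks
-- B along < and y ranks B along >: labels are positive, grow along forward steps of the
-- relation, and a label m + 1 ≥ 2 at j is reached from an earlier label m.  Hence, in
-- every such B and so in the poset P = P(T):
--   crossing: if i comes before j and lab j ≤ lab i, then j is below i (B is injective);
--   stepDown: the LAST position before j labelled lab j - 1 is below j.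
-- Iterating stepDown builds staircases in P: r ⇝ u₁ down the y-labels (y u₁ = y s + 1),
-- v₁ ⇝ s down the x-labels (x v₁ = x r + 1), one more step giving u₀ and v₀.  As r, s
-- are consecutive corners, no point of T lies strictly north-east of (x r , y s) (the
-- one with maximal x + y would be a corner between them), so crossing joins u₁ to v₁
-- through u₀ or v₀; the chain r ⇝ u₁ → w → v₁ ⇝ s has (y r - y s) + (x s - x r) steps.

open import Defs
open import Data.Nat using (ℕ; zero; suc; _+_; _∸_; _≤_; _<_; _>_; s≤s; z≤n; _≤?_; _<?_; _≟_)
open import Data.Nat.Properties
  using ( ≤-refl; ≤-reflexive; ≤-trans; ≤-antisym; <⇒≤; <⇒≱; ≰⇒>; ≮⇒≥; ≤-pred
        ; suc-injective; m≤n⇒m<n∨m≡n; m≤n+m; +-suc; m+n∸n≡m; m∸n+n≡m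
        ; +-mono-<-≤; +-mono-≤-<; ≤∧≢⇒<; <-isStrictTotalOrder)
open import Data.Fin using (Fin; zero; suc; inject₁; fromℕ; toℕ)
  renaming (_<_ to _<ᶠ_; _≤_ to _≤ᶠ_)
open import Data.Fin.Properties using (toℕ-injective)
  renaming (<-cmp to <ᶠ-cmp; <-trans to <ᶠ-trans; <-irrefl to <ᶠ-irrefl; _<?_ to _<ᶠ?_)
open import Data.Fin.Relation.Unary.Top using (view; ‵fromℕ; ‵inj₁)
open import Data.Product using (Σ; ∃; _×_; _,_; proj₁; proj₂)
open import Data.Sum using (_⊎_; inj₁; inj₂)
open import Data.Empty using (⊥-elim)
open import Function using (flip; _∘_)
open import Relation.Nullary using (¬_; Dec; yes; no)
open import Relation.Nullary.Decidable using (_×-dec_)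
open import Relation.Binary using (IsStrictTotalOrder; tri<; tri≈; tri>)
import Relation.Binary.Construct.Flip.EqAndOrd as Flip
open import Relation.Binary.PropositionalEquality
  using (_≡_; refl; sym; trans; cong; cong₂; subst; subst₂; module ≡-Reasoning)

argmax : ∀ {n} (P : Fin n → Set) → (∀ i → Dec (P i)) → (f : Fin n → ℕ) →
  (∀ i → ¬ P i) ⊎ Σ (Fin n) λ i → P i × (∀ j → P j → f j ≤ f i)
argmax {zero} P P? f = inj₁ λ ()
argmax {suc n} P P? f with argmax (P ∘ suc) (P? ∘ suc) (f ∘ suc) | P? zero
... | inj₁ none | no ¬p₀ = inj₁ λ { zero p₀ → ¬p₀ p₀ ; (suc j) pj → none j pj }
... | inj₁ none | yes p₀ =
  inj₂ (zero , p₀ , λ { zero _ → ≤-refl ; (suc j) pj → ⊥-elim (none j pj) })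
... | inj₂ (i , pi , max) | no ¬p₀ =
  inj₂ (suc i , pi , λ { zero p₀ → ⊥-elim (¬p₀ p₀) ; (suc j) pj → max j pj })
... | inj₂ (i , pi , max) | yes p₀ with f zero ≤? f (suc i)
...   | yes f₀≤ = inj₂ (suc i , pi , λ { zero _ → f₀≤ ; (suc j) pj → max j pj })
...   | no f₀≰ =
  inj₂ (zero , p₀ , λ { zero _ → ≤-refl ; (suc j) pj → ≤-trans (max j pj) (<⇒≤ (≰⇒> f₀≰)) })

argmaxOf : ∀ {n} (P : Fin n → Set) → (∀ i → Dec (P i)) → (f : Fin n → ℕ) →
  ∀ {e} → P e → Σ (Fin n) λ i → P i × (∀ j → P j → f j ≤ f i)
argmaxOf P P? f {e} pe with argmax P P? f
... | inj₁ none = ⊥-elim (none e pe)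
... | inj₂ best = best

snoc : ∀ {L} {X : Set} → (Fin (suc L) → X) → X → Fin (suc (suc L)) → X
snoc {zero} p x zero = p zero
snoc {zero} p x (suc zero) = x
snoc {suc L} p x zero = p zero
snoc {suc L} p x (suc k) = snoc (p ∘ suc) x k

snoc-inject₁ : ∀ {L} {X : Set} (p : Fin (suc L) → X) x k → snoc p x (inject₁ k) ≡ p k
snoc-inject₁ {zero} p x zero = refl
snoc-inject₁ {suc L} p x zero = refl
snoc-inject₁ {suc L} p x (suc k) = snoc-inject₁ (p ∘ suc) x k

snoc-last : ∀ {L} {X : Set} (p : Fin (suc L) → X) x → snoc p x (fromℕ (suc L)) ≡ x
snoc-last {zero} p x = refl
snoc-last {suc L} p x = snoc-last (p ∘ suc) x

snoc-adjacent : ∀ {L} {X : Set} (Q : X → X → Set) (p : Fin (suc L) → X) {x} →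
  (∀ k → Q (p (inject₁ k)) (p (suc k))) → Q (p (fromℕ L)) x →
  ∀ k → Q (snoc p x (inject₁ k)) (snoc p x (suc k))
snoc-adjacent {L} Q p {x} along last k with view k
... | ‵fromℕ = subst₂ Q (sym (snoc-inject₁ p x (fromℕ L))) (sym (snoc-last p x)) last
... | ‵inj₁ {i = k′} _ =
  subst₂ Q (sym (snoc-inject₁ p x (inject₁ k′))) (sym (snoc-inject₁ p x (suc k′))) (along k′)

module Runs {n : ℕ} (R : ℕ → ℕ → Set) (B : Seq n) where

  -- An R-run of length suc L ending at position i.  For R = _<_ (resp. _>_) this is
  -- literally IncSubseqEndingAt B i (suc L) (resp. DecSubseqEndingAt B i (suc L)).
  Run : Fin n → ℕ → Set
  Run i L = Σ (Fin (suc L) → Fin n) λ p →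
    (∀ k → p (inject₁ k) <ᶠ p (suc k)) ×
    (∀ k → R (B (p (inject₁ k))) (B (p (suc k)))) ×
    (p (fromℕ L) ≡ i)

  extend : ∀ {i j L} → Run i L → i <ᶠ j → R (B i) (B j) → Run j (suc L)
  extend {j = j} (p , increasing , related , refl) i<j r =
    snoc p j ,
    snoc-adjacent _<ᶠ_ p increasing i<j ,
    snoc-adjacent (λ a b → R (B a) (B b)) p related r ,
    snoc-last p j

  truncate : ∀ {j L} → Run j (suc L) → Σ (Fin n) λ e → e <ᶠ j × R (B e) (B j) × Run e L
  truncate {L = L} (p , increasing , related , refl) =
    p (inject₁ (fromℕ L)) , increasing (fromℕ L) , related (fromℕ L) ,
    (p ∘ inject₁ , increasing ∘ inject₁ , related ∘ inject₁ , refl)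

record Ranking {n : ℕ} (R : ℕ → ℕ → Set) (B : Seq n) (lab : Fin n → ℕ) : Set where
  field
    positive    : ∀ i → 1 ≤ lab i
    grows       : ∀ {i j} → i <ᶠ j → R (B i) (B j) → lab i < lab j
    predecessor : ∀ {j m} → lab j ≡ suc m → 1 ≤ m →
                  Σ (Fin n) λ e → e <ᶠ j × R (B e) (B j) × lab e ≡ m

module _ {n : ℕ} (R : ℕ → ℕ → Set) (B : Seq n) where
  open Runs R B

  longestRuns : (lab : Fin n → ℕ) →
    (∀ i → Σ ℕ λ L → lab i ≡ suc L × Run i L) → (∀ i L → Run i L → suc L ≤ lab i) →
    Ranking R B lab
  longestRuns lab attained bounded =
    record { positive = positive ; grows = grows ; predecessor = predecessor }
    where
    positive : ∀ i → 1 ≤ lab i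
    positive i with attained i
    ... | _ , labi , _ = subst (1 ≤_) (sym labi) (s≤s z≤n)

    grows : ∀ {i j} → i <ᶠ j → R (B i) (B j) → lab i < lab j
    grows {i} {j} i<j r with attained i
    ... | L , labi , run = subst (_< lab j) (sym labi) (bounded j (suc L) (extend run i<j r))

    predecessor : ∀ {j m} → lab j ≡ suc m → 1 ≤ m →
                  Σ (Fin n) λ e → e <ᶠ j × R (B e) (B j) × lab e ≡ m
    predecessor {j} {suc m} labj _ with attained j
    ... | L , labj′ , run with truncate (subst (Run j) (suc-injective (trans (sym labj′) labj)) run)
    ...   | e , e<j , r , shorter =
      e , e<j , r , ≤-antisym (≤-pred (subst (lab e <_) labj (grows e<j r))) (bounded e m shorter)

incRanking : ∀ {n} {B : Seq n} {t : Fin n → Point} → IsEST B t → Ranking _<_ B (proj₁ ∘ t)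
incRanking {B = B} {t} est = longestRuns _<_ B (proj₁ ∘ t) attained bounded
  where
  attained : ∀ i → Σ ℕ λ L → proj₁ (t i) ≡ suc L × Runs.Run _<_ B i L
  attained i with proj₁ (t i) | proj₁ (proj₁ (est i))
  ... | suc L | run = L , refl , run
  bounded : ∀ i L → Runs.Run _<_ B i L → suc L ≤ proj₁ (t i)
  bounded i L = proj₂ (proj₁ (est i)) (suc L)

decRanking : ∀ {n} {B : Seq n} {t : Fin n → Point} → IsEST B t → Ranking _>_ B (proj₂ ∘ t)
decRanking {B = B} {t} est = longestRuns _>_ B (proj₂ ∘ t) attained bounded
  where
  attained : ∀ i → Σ ℕ λ L → proj₂ (t i) ≡ suc L × Runs.Run _>_ B i L
  attained i with proj₂ (t i) | proj₁ (proj₂ (est i))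
  ... | suc L | run = L , refl , run
  bounded : ∀ i L → Runs.Run _>_ B i L → suc L ≤ proj₂ (t i)
  bounded i L = proj₂ (proj₂ (est i)) (suc L)

module Ranked {n : ℕ} {R : ℕ → ℕ → Set} (order : IsStrictTotalOrder _≡_ R)
              {B : Seq n} (distinct : Distinct B) {lab : Fin n → ℕ} (ranking : Ranking R B lab) where
  open IsStrictTotalOrder order using (compare; irrefl) renaming (trans to R-trans)
  open Ranking ranking

  crossing : ∀ {i j} → i <ᶠ j → lab j ≤ lab i → R (B j) (B i)
  crossing i<j labj≤ with compare (B _) (B _)
  ... | tri< r _ _ = ⊥-elim (<⇒≱ (grows i<j r) labj≤)
  ... | tri≈ _ same _ = ⊥-elim (<ᶠ-irrefl (distinct same) i<j)
  ... | tri> _ _ r = r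

  -- The last position before j labelled lab j - 1 is R-below j: the predecessor of j
  -- is either that position, or an earlier one with the same label, hence R-above it.
  lastPredecessor : ∀ {i j m} → lab j ≡ suc m → 1 ≤ m → i <ᶠ j → lab i ≡ m →
    (∀ i′ → i′ <ᶠ j → lab i′ ≡ m → i′ ≤ᶠ i) → R (B i) (B j)
  lastPredecessor labj m≥1 i<j labi isLast with predecessor labj m≥1
  ... | e , e<j , r , labe with m≤n⇒m<n∨m≡n (isLast e e<j labe)
  ...   | inj₂ e≡i rewrite toℕ-injective e≡i = r
  ...   | inj₁ e<i = R-trans (crossing e<i (≤-reflexive (trans labi (sym labe)))) r

  descend : ∀ {j c} d → lab j ≡ d + c → 1 ≤ c → Σ (Fin n) λ e → ¬ R (B j) (B e) × lab e ≡ c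
  descend {j} zero labj _ = j , irrefl refl , labj
  descend {c = c} (suc d) labj c≥1 with predecessor labj (≤-trans c≥1 (m≤n+m c d))
  ... | e₁ , _ , r , labe₁ with descend d labe₁ c≥1
  ...   | e , ¬r , labe = e , (λ r′ → ¬r (R-trans r r′)) , labe

_≼_ : Point → Point → Set
(a , b) ≼ (c , d) = a ≤ c × b ≤ d

_≺_ : Point → Point → Set
(a , b) ≺ (c , d) = a < c × b < d

shadowDominated : ∀ {n} {t : Fin n → Point} {q} → InShadow t q → Σ (Fin n) λ i → q ≼ t i
shadowDominated (i , inj₁ (refl , _ , x≤)) = i , x≤ , ≤-refl
shadowDominated (i , inj₂ (refl , _ , y≤)) = i , ≤-refl , y≤

-- Among the points of T strictly north-east of o, one with maximal coordinate sum is a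
-- corner: nothing of T (hence of the shadow) lies to its right or above it.
maxSumCorner : ∀ {n} (t : Fin n → Point) {o} p → o ≺ t p →
  (∀ i → o ≺ t i → proj₁ (t i) + proj₂ (t i) ≤ proj₁ (t p) + proj₂ (t p)) → IsCorner t (t p)
maxSumCorner {n} t p (ox< , oy<) maximal =
  ((p , refl) , inj₂ noRow) , beyondRight ∘ shadowDominated , beyondAbove ∘ shadowDominated
  where
  beyondRight : ¬ Σ (Fin n) λ i → (suc (proj₁ (t p)) , proj₂ (t p)) ≼ t i
  beyondRight (i , x< , y≤) =
    <⇒≱ (+-mono-<-≤ x< y≤) (maximal i (≤-trans ox< (<⇒≤ x<) , ≤-trans oy< y≤))
  beyondAbove : ¬ Σ (Fin n) λ i → (proj₁ (t p) , suc (proj₂ (t p))) ≼ t i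
  beyondAbove (i , x≤ , y<) =
    <⇒≱ (+-mono-≤-< x≤ y<) (maximal i (≤-trans ox< x≤ , ≤-trans oy< (<⇒≤ y<)))
  noRow : ¬ ∃ λ q → q ∈T t × InRow (t p) q
  noRow (_ , (i , refl) , same-y , x<) = beyondRight (i , x< , ≤-reflexive (sym same-y))

module Tableau {n : ℕ} {A : Seq n} {t : Fin n → Point} (distinct : Distinct A) (est : IsEST A t) where

  x y : Fin n → ℕ
  x i = proj₁ (t i)
  y i = proj₂ (t i)

  module RankedX = Ranked <-isStrictTotalOrder distinct (incRanking est)
  module RankedY = Ranked (Flip.isStrictTotalOrder <-isStrictTotalOrder) distinct (decRanking est)

  x-positive : ∀ i → 1 ≤ x i
  x-positive = Ranking.positive (incRanking est)

  y-positive : ∀ i → 1 ≤ y i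
  y-positive = Ranking.positive (decRanking est)

  separated : ∀ {e f} → A e ≤ A f → e ≡ f ⊎ x e < x f ⊎ y f < y e
  separated {e} {f} Ae≤Af with <ᶠ-cmp e f
  ... | tri≈ _ e≡f _ = inj₁ e≡f
  ... | tri< e<f _ _ = inj₂ (inj₁ (Ranking.grows (incRanking est) e<f Ae<Af))
    where
    Ae<Af : A e < A f
    Ae<Af = ≤∧≢⇒< Ae≤Af (λ same → <ᶠ-irrefl (distinct same) e<f)
  ... | tri> _ _ f<e = inj₂ (inj₂ (Ranking.grows (decRanking est) f<e Ae<Af))
    where
    Ae<Af : A e < A f
    Ae<Af = ≤∧≢⇒< Ae≤Af (λ same → <ᶠ-irrefl (distinct (sym same)) f<e)

  -- Every point with positive coordinates weakly south-west of a point of T lies in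
  -- the shadow: descending from j along both labels reaches a position e in column x′
  -- and a position f in row y′ with A e ≤ A j ≤ A f, and one of them reaches (x′ , y′).
  belowInShadow : ∀ j {p} → 1 ≤ proj₁ p → 1 ≤ proj₂ p → p ≼ t j → InShadow t p
  belowInShadow j {x′ , y′} x′≥1 y′≥1 (x′≤ , y′≤)
    with RankedX.descend (x j ∸ x′) (sym (m∸n+n≡m x′≤)) x′≥1
       | RankedY.descend (y j ∸ y′) (sym (m∸n+n≡m y′≤)) y′≥1
  ... | e , Aj≮Ae , refl | f , Af≮Aj , refl with separated (≤-trans (≮⇒≥ Aj≮Ae) (≮⇒≥ Af≮Aj))
  ...   | inj₁ refl = e , inj₂ (refl , y′≥1 , ≤-refl)
  ...   | inj₂ (inj₁ xe<xf) = f , inj₁ (refl , x′≥1 , <⇒≤ xe<xf)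
  ...   | inj₂ (inj₂ yf<ye) = e , inj₂ (refl , y′≥1 , <⇒≤ yf<ye)

  -- Consecutive corners descend: y s < y r, for otherwise (x r + 1 , y r) is in the shadow.
  cornersDescend : ∀ {r s} → ConsecutiveCorners t (t r) (t s) → y s < y r
  cornersDescend {r} {s} (rCorner , _ , xr<xs , _) =
    ≰⇒> λ yr≤ys → proj₁ (proj₂ rCorner) (belowInShadow s (s≤s z≤n) (y-positive r) (xr<xs , yr≤ys))

  -- Between consecutive corners r, s no point of T lies strictly north-east of (x r , y s):
  -- the maximal-sum such point would be a corner p with x r < x p, so x s ≤ x p, and
  -- then (x s , y s + 1) would lie in the shadow.
  emptyBetween : ∀ {r s} → ConsecutiveCorners t (t r) (t s) → ∀ i → ¬ (x r , y s) ≺ t i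
  emptyBetween {r} {s} (_ , sCorner , _ , consecutive) i inside
    with argmaxOf (λ i → (x r , y s) ≺ t i) (λ i → (x r <? x i) ×-dec (y s <? y i))
                  (λ i → x i + y i) inside
  ... | p , (xr<xp , ys<yp) , maximal =
    proj₂ (proj₂ sCorner) (belowInShadow p (x-positive s) (s≤s z≤n) (xs≤xp , ys<yp))
    where
    xs≤xp : x s ≤ x p
    xs≤xp = ≮⇒≥ λ xp<xs → consecutive (t p) (maxSumCorner t p (xr<xp , ys<yp) maximal) (xr<xp , xp<xs)

data Path {n : ℕ} (_~_ : Fin n → Fin n → Set) : Fin n → Fin n → ℕ → Set where
  []  : ∀ {a} → Path _~_ a a 0
  _∷_ : ∀ {a b c m} → a ~ b → Path _~_ b c m → Path _~_ a c (suc m)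

module _ {n : ℕ} {_~_ : Fin n → Fin n → Set} where

  _∷ʳ_ : ∀ {a b c m} → Path _~_ a b m → b ~ c → Path _~_ a c (suc m)
  [] ∷ʳ e′ = e′ ∷ []
  (e ∷ p) ∷ʳ e′ = e ∷ (p ∷ʳ e′)

  _++_ : ∀ {a b c m k} → Path _~_ a b m → Path _~_ b c k → Path _~_ a c (m + k)
  [] ++ q = q
  (e ∷ p) ++ q = e ∷ (p ++ q)

  reverse : ∀ {a b m} → Path (flip _~_) a b m → Path _~_ b a m
  reverse [] = []
  reverse (e ∷ p) = reverse p ∷ʳ e

  vertex : ∀ {a b m} → Path _~_ a b m → Fin (suc m) → Fin n
  vertex {a} [] _ = a
  vertex {a} (_ ∷ _) zero = a
  vertex (_ ∷ p) (suc k) = vertex p k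

  vertex-first : ∀ {a b m} (p : Path _~_ a b m) → vertex p zero ≡ a
  vertex-first [] = refl
  vertex-first (_ ∷ _) = refl

  vertex-last : ∀ {a b m} (p : Path _~_ a b m) → vertex p (fromℕ m) ≡ b
  vertex-last [] = refl
  vertex-last (_ ∷ p) = vertex-last p

  vertex-steps : ∀ {a b m} (p : Path _~_ a b m) k → vertex p (inject₁ k) ~ vertex p (suc k)
  vertex-steps (_∷_ {a} e p) zero = subst (a ~_) (sym (vertex-first p)) e
  vertex-steps (e ∷ p) (suc k) = vertex-steps p k

toChain : ∀ {n} {t : Fin n → Point} {a b k} → Path (_<[ t ]_) a b (suc k) → ChainWith t a b k
toChain p = vertex p , vertex-first p , vertex-last p , vertex-steps p

module Side {n : ℕ} (t : Fin n → Point) {R : ℕ → ℕ → Set} (order : IsStrictTotalOrder _≡_ R)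
            (coord : Point → ℕ) (ranked : ∀ {B} → IsEST B t → Ranking R B (coord ∘ t)) where

  lab : Fin n → ℕ
  lab i = coord (t i)

  Related : Fin n → Fin n → Set
  Related i j = ∀ (B : Seq n) → Distinct B → IsEST B t → R (B i) (B j)

  crossing : ∀ {i j} → i <ᶠ j → lab j ≤ lab i → Related j i
  crossing i<j labj≤ B distinct est = Ranked.crossing order distinct (ranked est) i<j labj≤

  -- Given one sequence realising t, every label m + 1 ≥ 2 at j has an earlier position
  -- labelled m that is Related to j: the last such position.
  module _ {A : Seq n} (est : IsEST A t) where

    stepDown : ∀ {j m} → lab j ≡ suc m → 1 ≤ m → Σ (Fin n) λ i → i <ᶠ j × lab i ≡ m × Related i j
    stepDown {j} {m} labj m≥1 with Ranking.predecessor (ranked est) labj m≥1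
    ... | e , e<j , _ , labe
      with argmaxOf (λ i → i <ᶠ j × lab i ≡ m) (λ i → (i <ᶠ? j) ×-dec (lab i ≟ m)) toℕ (e<j , labe)
    ...   | i , (i<j , labi) , isLast =
      i , i<j , labi , λ B distinct est′ →
        Ranked.lastPredecessor order distinct (ranked est′) labj m≥1 i<j labi λ i′ i′<j labi′ →
          isLast i′ (i′<j , labi′)

    descent : ∀ {j c} d → lab j ≡ d + c → 1 ≤ c → Σ (Fin n) λ e → lab e ≡ c × Path Related e j d
    descent {j} zero labj _ = j , labj , []
    descent {c = c} (suc d) labj c≥1 with stepDown labj (≤-trans c≥1 (m≤n+m c d))
    ... | i , _ , labi , i~j with descent d labi c≥1
    ...   | e , labe , e⇝i = e , labe , e⇝i ∷ʳ i~j

-- Related along x is i <_P j; related along y is j <_P i.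
module Rising {n} (t : Fin n → Point) = Side t <-isStrictTotalOrder proj₁ incRanking
module Falling {n} (t : Fin n → Point) = Side t (Flip.isStrictTotalOrder <-isStrictTotalOrder) proj₂ decRanking

bridge : ∀ {n} {t : Fin n → Point} {ox oy} {u₀ u₁ v₀ v₁ : Fin n} → (∀ i → ¬ (ox , oy) ≺ t i) →
  u₀ <ᶠ u₁ → proj₂ (t u₀) ≡ oy → proj₂ (t u₁) ≡ suc oy → u₁ <[ t ] u₀ →
  v₀ <ᶠ v₁ → proj₁ (t v₀) ≡ ox → proj₁ (t v₁) ≡ suc ox → v₀ <[ t ] v₁ →
  Σ (Fin n) λ w → u₁ <[ t ] w × w <[ t ] v₁
bridge {t = t} {u₀ = u₀} {u₁} {v₀} {v₁} empty u₀<u₁ refl yu₁ u₁<ₚu₀ v₀<v₁ refl xv₁ v₀<ₚv₁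
  with <ᶠ-cmp u₀ v₀
... | tri≈ _ refl _ = u₀ , u₁<ₚu₀ , v₀<ₚv₁
... | tri< u₀<v₀ _ _ = u₀ , u₁<ₚu₀ , Falling.crossing t (<ᶠ-trans u₀<v₀ v₀<v₁) yv₁≤yu₀
  where
  yv₁≤yu₀ : proj₂ (t v₁) ≤ proj₂ (t u₀)
  yv₁≤yu₀ = ≮⇒≥ λ yu₀<yv₁ → empty v₁ (≤-reflexive (sym xv₁) , yu₀<yv₁)
... | tri> _ _ v₀<u₀ = v₀ , Rising.crossing t (<ᶠ-trans v₀<u₀ u₀<u₁) xu₁≤xv₀ , v₀<ₚv₁
  where
  xu₁≤xv₀ : proj₁ (t u₁) ≤ proj₁ (t v₀)
  xu₁≤xv₀ = ≮⇒≥ λ xv₀<xu₁ → empty u₁ (xv₀<xu₁ , ≤-reflexive (sym yu₁))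

gap : ∀ {m n} → m < n → Σ ℕ λ d → n ≡ d + suc m × n ∸ m ≡ suc d
gap {m} {n} m<n = d , n≡ , difference
  where
  open ≡-Reasoning
  d : ℕ
  d = n ∸ suc m
  n≡ : n ≡ d + suc m
  n≡ = sym (m∸n+n≡m m<n)
  difference : n ∸ m ≡ suc d
  difference = begin
    n ∸ m           ≡⟨ cong (_∸ m) n≡ ⟩
    d + suc m ∸ m   ≡⟨ cong (_∸ m) (+-suc d m) ⟩
    suc d + m ∸ m   ≡⟨ m+n∸n≡m (suc d) m ⟩
    suc d           ∎

-- The chain r ⇝ u₁ → w → v₁ ⇝ s has a + 1 + 1 + b steps, where y r - y s = a + 1 and
-- x s - x r = b + 1.
lemma7 : ∀ (n : ℕ) (A : Seq n) (t : Fin n → Point) → Distinct A → IsEST A t →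
    ∀ (r s : Fin n) → ConsecutiveCorners t (t r) (t s) →
    ∃ λ k → ChainWith t r s k ×
      (proj₂ (t r) ∸ proj₂ (t s)) + (proj₁ (t s) ∸ proj₁ (t r)) ≤ suc k
lemma7 n A t distinct est r s consecutive =
  let open Tableau distinct est
      a , yr≡ , y-gap = gap (cornersDescend consecutive)
      _ , _ , xr<xs , _ = consecutive
      b , xs≡ , x-gap = gap xr<xs
      u₁ , yu₁ , u₁⇝r = Falling.descent t est a yr≡ (s≤s z≤n)
      v₁ , xv₁ , v₁⇝s = Rising.descent t est b xs≡ (s≤s z≤n)
      u₀ , u₀<u₁ , yu₀ , u₁<ₚu₀ = Falling.stepDown t est yu₁ (y-positive s)
      v₀ , v₀<v₁ , xv₀ , v₀<ₚv₁ = Rising.stepDown t est xv₁ (x-positive r)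
      w , u₁<ₚw , w<ₚv₁ = bridge (emptyBetween consecutive) u₀<u₁ yu₀ yu₁ u₁<ₚu₀ v₀<v₁ xv₀ xv₁ v₀<ₚv₁
      r⇝s = reverse {_~_ = _<[ t ]_} u₁⇝r ++ (u₁<ₚw ∷ (w<ₚv₁ ∷ v₁⇝s))
  in a + suc b ,
     toChain (subst (Path _<[ t ]_ r s) (+-suc a (suc b)) r⇝s) ,
     ≤-reflexive (cong₂ _+_ y-gap x-gap)
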